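{- Let $\mu$ be a $p$-symmetric fuzzy measure on $X=\{x_1,\dots,x_n\}$ with respect to the partition $\{A_1,\dots,A_p\}$, with Möbius transform $m$, and let $f:X\to[0,\infty)$. Let $x_{(1)},\dots,x_{(n)}$ be a reordering with $f(x_{(1)})\le\dots\le f(x_{(n)})$. For each $i$, let $j(i)$ be the index with $x_{(i)}\in A_{j(i)}$ and let $(b_1^{i},\dots,b_p^{i})$ be the profile of $\{x_{(i+1)},\dots,x_{(n)}\}$. Then $$\mathcal C_\mu(f)=\sum_{i=1}^n f(x_{(i)})\sum_{c_k\le b_k^{i},\ \forall k}\ m(c_1,\dots,c_{j(i)}+1,\dots,c_p)\prod_{k=1}^p\binom{b_k^{i}}{c_k},$$ where the inner sum runs over integers $0\le c_k\le b_k^{i}$ and $m(c_1,\dots,c_{j(i)}+1,\dots,c_p)$ is the value of $m$ on sets with that profile.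
   Context: A fuzzy measure on a finite set $X$ is a set function $\mu:\mathcal P(X)\to[0,1]$ with $\mu(\emptyset)=0$, $\mu(X)=1$, and monotone. A subset $A\subset X$ is a set of indifference for $\mu$ if for all $B_1,B_2\subset A$ with $|B_1|=|B_2|$ and all $C\subset X\setminus A$, $\mu(B_1\cup C)=\mu(B_2\cup C)$. $\mu$ is $p$-symmetric with respect to the partition $\{A_1,\dots,A_p\}$ of $X$ (all $A_i\ne\emptyset$) if this is the coarsest partition of $X$ into sets of indifference for $\mu$. The profile of $C\subset X$ is $(c_1,\dots,c_p)$ with $c_i=|C\cap A_i|$. The Möbius transform is $m(A)=\sum_{B\subset A}(-1)^{|A\setminus B|}\mu(B)$; for $p$-symmetric $\mu$, $m(C)$ depends only on the profile of $C$, and $m(c_1,\dots,c_p)$ denotes this common value. The Choquet integral of $f:X\to[0,\infty)$ is $\mathcal C_\mu(f)=\sum_{i=1}^n f(x_{(i)})\big(\mu(B_i)-\mu(B_{i+1})\big)$, where $f(x_{(1)})\le\dots\le f(x_{(n)})$, $B_i=\{x_{(i)},\dots,x_{(n)}\}$, $B_{n+1}=\emptyset$. -}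

module Defs where

open import Level using (Level; _⊔_)
open import Data.Nat as ℕ using (ℕ; zero; suc; _∸_)
open import Data.Nat.Combinatorics using (_C_)
open import Data.Bool using (Bool; true; false; if_then_else_)
open import Data.Fin as Fin using (Fin; toℕ)
open import Data.Fin.Subset using (Subset; inside; outside; ⊥; ⊤; _⊆_; _∩_; _∪_; ∁; ∣_∣; _∈_)
open import Data.Fin.Permutation using (Permutation′; _⟨$⟩ʳ_; _⟨$⟩ˡ_)
open import Data.Vec as Vec using (Vec; []; _∷_; tabulate; lookup; updateAt)
open import Data.List as List using (List; []; _∷_; _++_; concatMap; upTo)
open import Data.Product using (∃)
open import Relation.Nullary.Decidable using (⌊_⌋)
open import Relation.Binary.PropositionalEquality using (_≡_)
open import Relation.Binary using (Rel)
open import Function using (Surjective)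
open import Algebra.Bundles using (CommutativeRing; Semiring)

subsets : ∀ n → List (Subset n)
subsets zero    = [] ∷ []
subsets (suc n) = List.map (inside ∷_) (subsets n) ++ List.map (outside ∷_) (subsets n)

box : ∀ {p} → Vec ℕ p → List (Vec ℕ p)
box []       = [] ∷ []
box (b ∷ bs) = concatMap (λ c → List.map (c ∷_) (box bs)) (upTo (suc b))

block : ∀ {n p} → (Fin n → Fin p) → Fin p → Subset n
block blk k = tabulate (λ x → ⌊ blk x Fin.≟ k ⌋)

profile : ∀ {n p} → (Fin n → Fin p) → Subset n → Vec ℕ p
profile blk C = tabulate (λ k → ∣ C ∩ block blk k ∣)

rankInBlock : ∀ {n p} → (Fin n → Fin p) → Fin n → ℕ
rankInBlock {n} blk x =
  ∣ tabulate {n = n} (λ y → ⌊ Fin._<?_ y x ⌋ Data.Bool.∧ ⌊ blk y Fin.≟ blk x ⌋) ∣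
  where import Data.Bool

-- canonical set with a given profile c: the first c_k elements of each A_k
canonical : ∀ {n p} → (Fin n → Fin p) → Vec ℕ p → Subset n
canonical blk c = tabulate (λ x → ⌊ rankInBlock blk x ℕ.<? lookup c (blk x) ⌋)

-- B_i = {x_(i), ..., x_(n)} (0-indexed: elements at sorted position ≥ i)
upperSet : ∀ {n} → Permutation′ n → ℕ → Subset n
upperSet σ i = tabulate (λ x → ⌊ i ℕ.≤? toℕ (σ ⟨$⟩ˡ x) ⌋)

module _ {c ℓ ℓ′ : Level} (R : CommutativeRing c ℓ) (_≤_ : Rel (CommutativeRing.Carrier R) ℓ′) where
  open CommutativeRing R renaming (Carrier to K)
  open import Algebra.Definitions.RawSemiring (Semiring.rawSemiring semiring) using () renaming (_×_ to _·ℕ_)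

  ΣL : {A : Set} → List A → (A → K) → K
  ΣL xs g = List.foldr (λ a s → g a + s) 0# xs

  ΣF : ∀ {n} → (Fin n → K) → K
  ΣF {zero}  g = 0#
  ΣF {suc n} g = g Fin.zero + ΣF (λ i → g (Fin.suc i))

  record IsFuzzyMeasure {n : ℕ} (μ : Subset n → K) : Set (c ⊔ ℓ ⊔ ℓ′) where
    field
      empty    : μ ⊥ ≈ 0#
      full     : μ ⊤ ≈ 1#
      lower    : ∀ A → 0# ≤ μ A
      upper    : ∀ A → μ A ≤ 1#
      monotone : ∀ {A B} → A ⊆ B → μ A ≤ μ B

  IsIndifferent : ∀ {n} → (Subset n → K) → Subset n → Set ℓ
  IsIndifferent μ A = ∀ B₁ B₂ C → B₁ ⊆ A → B₂ ⊆ A → ∣ B₁ ∣ ≡ ∣ B₂ ∣ → C ⊆ ∁ A →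
                      μ (B₁ ∪ C) ≈ μ (B₂ ∪ C)

  -- a partition into q nonempty blocks given by blk : X → Fin q (surjective),
  -- all of whose blocks are sets of indifference
  IsIndifferencePartition : ∀ {n q} → (Subset n → K) → (Fin n → Fin q) → Set ℓ
  IsIndifferencePartition {q = q} μ blk = Surjective _≡_ _≡_ blk × (∀ k → IsIndifferent μ (block blk k))
    where open import Data.Product using (_×_)

  -- μ is p-symmetric w.r.t. the partition blk: blk is a partition into sets of
  -- indifference, and it is the coarsest one (every other such partition refines it)
  IsPSymmetric : ∀ {n p} → (Subset n → K) → (Fin n → Fin p) → Set ℓ
  IsPSymmetric {n} μ blk =
    IsIndifferencePartition μ blk ×
    (∀ q (g : Fin n → Fin q) → IsIndifferencePartition μ g → ∀ x y → g x ≡ g y → blk x ≡ blk y)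
    where open import Data.Product using (_×_)

  sign : ℕ → K
  sign zero    = 1#
  sign (suc k) = - sign k

  möbius : ∀ {n} → (Subset n → K) → Subset n → K
  möbius {n} μ A = ΣL (subsets n) (λ B → if ⌊ B ⊆? A ⌋ then sign (∣ A ∣ ∸ ∣ B ∣) * μ B else 0#)
    where open import Data.Fin.Subset.Properties using (_⊆?_)

  -- m(c_1,...,c_p): the Möbius transform at (a canonical) set with profile c
  möbiusProfile : ∀ {n p} → (Subset n → K) → (Fin n → Fin p) → Vec ℕ p → K
  möbiusProfile μ blk c = möbius μ (canonical blk c)

  -- Choquet integral of f w.r.t. μ, computed along an ordering σ with
  -- f(σ 0) ≤ ... ≤ f(σ (n-1))
  choquet : ∀ {n} → (Subset n → K) → (Fin n → K) → Permutation′ n → K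
  choquet μ f σ = ΣF (λ i → f (σ ⟨$⟩ʳ i) * (μ (upperSet σ (toℕ i)) - μ (upperSet σ (suc (toℕ i)))))

  Sorts : ∀ {n} → (Fin n → K) → Permutation′ n → Set ℓ′
  Sorts f σ = ∀ i j → i Fin.≤ j → f (σ ⟨$⟩ʳ i) ≤ f (σ ⟨$⟩ʳ j)

  binomProd : ∀ {p} → Vec ℕ p → Vec ℕ p → ℕ
  binomProd b c = Vec.foldr _ ℕ._*_ 1 (Vec.zipWith _C_ b c)

  rhs : ∀ {n p} → (Subset n → K) → (Fin n → Fin p) → (Fin n → K) → Permutation′ n → K
  rhs μ blk f σ = ΣF λ i →
    let x  = σ ⟨$⟩ʳ i
        b  = profile blk (upperSet σ (suc (toℕ i)))
    in f x * ΣL (box b) (λ cs →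
         binomProd b cs ·ℕ möbiusProfile μ blk (updateAt cs (blk x) suc))

module Submission where

-- With B_i = {x_(i), ..., x_(n)} the Choquet integral is Σ_i f(x_(i)) (μ(B_i) - μ(B_{i+1})),
-- and B_i = B_{i+1} ∪ {x_(i)}.  So it suffices to show, for x ∉ S and b the profile of S,
--     μ(S ∪ {x}) - μ(S) = Σ_{c ≤ b} Π_k C(b_k, c_k) m(c + e_{j(x)}).              (★)
-- By Möbius inversion μ(A) = Σ_{D ⊆ A} m(D), the left side is Σ_{D ⊆ S} m(D ∪ {x}).
-- As every block is a set of indifference, μ depends only on the profile (replace a set
-- by another one block at a time, each step an exchange inside one block), hence so does m,
-- and the profile of D ∪ {x} is that of D incremented at j(x).  Finally a sum over D ⊆ S
-- of a function of the profile of D is the binomially weighted sum over the box c ≤ b,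
-- by induction on S with Pascal's rule.

open import Defs
open import Level using (Level)
open import Function using (_∘_; id; mk⇔)
open import Data.Empty using (⊥-elim)
open import Data.Product using (_,_; proj₁; proj₂)
open import Data.Bool using (Bool; true; false; if_then_else_; not; _∧_)
open import Data.Bool.Properties using (∧-zeroʳ)
open import Data.Nat as ℕ using (ℕ; zero; suc; _∸_; pred)
import Data.Nat.Properties as ℕₚ
open import Data.Nat.Combinatorics using (_C_; nCk+nC[k+1]≡[n+1]C[k+1]; k>n⇒nCk≡0)
open import Data.Fin as Fin using (Fin; toℕ; _≟_)
import Data.Fin.Properties as Finₚ
open import Data.Fin.Subset using (Subset; _∉_; _⊆_; _∩_; _∪_; ∁; ∣_∣; ⊤)
open import Data.Fin.Subset.Properties
  using (_⊆?_; p⊆q⇒∣p∣≤∣q∣; p∩q⊆q; s⊆s; out⊆; x∈p∩q⁺; x∈p∩q⁻; ∈⊤; ∩-distribˡ-∪; ∩-identityʳ; p∪∁p≡⊤)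
open import Data.Fin.Permutation using (Permutation′; _⟨$⟩ʳ_; _⟨$⟩ˡ_; inverseˡ; inverseʳ)
open import Data.Vec as Vec using (Vec; []; _∷_; lookup; tabulate; updateAt; _[_]≔_; here; there)
import Data.Vec.Properties as Vecₚ
open import Data.List as List using (List; []; _∷_; _++_)
open import Relation.Nullary using (Dec; yes; no; ¬_)
open import Relation.Nullary.Decidable using (⌊_⌋; isYes≗does; dec-true; dec-false; does-⇔; ⌊⌋-map′)
open import Relation.Binary using (Rel)
open import Relation.Binary.PropositionalEquality as ≡ using (_≡_; _≢_)
open import Algebra.Bundles using (CommutativeRing)

module Combinatorics where
  open ≡ using (refl; sym; trans; cong; cong₂; subst; subst₂)
  open ≡.≡-Reasoning

  ⌊⌋-true : ∀ {A : Set} (a? : Dec A) → A → ⌊ a? ⌋ ≡ true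
  ⌊⌋-true a? a = trans (isYes≗does a?) (dec-true a? a)

  ⌊⌋-false : ∀ {A : Set} (a? : Dec A) → ¬ A → ⌊ a? ⌋ ≡ false
  ⌊⌋-false a? ¬a = trans (isYes≗does a?) (dec-false a? ¬a)

  ⌊⌋-iff : ∀ {A B : Set} (a? : Dec A) (b? : Dec B) → (A → B) → (B → A) → ⌊ a? ⌋ ≡ ⌊ b? ⌋
  ⌊⌋-iff a? b? f g = trans (isYes≗does a?) (trans (does-⇔ (mk⇔ f g) a? b?) (sym (isYes≗does b?)))

  ⌊⌋-true⇒ : ∀ {A : Set} (a? : Dec A) → ⌊ a? ⌋ ≡ true → A
  ⌊⌋-true⇒ (yes a) _ = a
  ⌊⌋-true⇒ (no _) ()

  vec-ext : ∀ {A : Set} {p} {u v : Vec A p} → (∀ k → lookup u k ≡ lookup v k) → u ≡ v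
  vec-ext {u = u} {v} u≗v =
    trans (sym (Vecₚ.tabulate∘lookup u)) (trans (Vecₚ.tabulate-cong u≗v) (Vecₚ.tabulate∘lookup v))

  incr : ∀ {p} → Vec ℕ p → Fin p → Vec ℕ p
  incr v j = updateAt v j suc

  incr-comm : ∀ {p} (v : Vec ℕ p) i j → incr (incr v i) j ≡ incr (incr v j) i
  incr-comm (a ∷ v) Fin.zero    Fin.zero    = refl
  incr-comm (a ∷ v) Fin.zero    (Fin.suc j) = refl
  incr-comm (a ∷ v) (Fin.suc i) Fin.zero    = refl
  incr-comm (a ∷ v) (Fin.suc i) (Fin.suc j) = cong (a ∷_) (incr-comm v i j)

  card-cons-block : ∀ {n p} (v : Vec ℕ p) (j k : Fin p) (X : Subset n) → ∣ X ∣ ≡ lookup v k →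
    ∣ ⌊ j ≟ k ⌋ ∷ X ∣ ≡ lookup (incr v j) k
  card-cons-block v j k X e with j ≟ k
  ... | yes refl = trans (cong suc e) (sym (Vecₚ.lookup∘updateAt j v))
  ... | no j≢k   = trans e (sym (Vecₚ.lookup∘updateAt′ k j (j≢k ∘ sym) v))

  profile-cons-in : ∀ {n p} (blk : Fin (suc n) → Fin p) (D : Subset n) →
    profile blk (true ∷ D) ≡ incr (profile (blk ∘ Fin.suc) D) (blk Fin.zero)
  profile-cons-in blk D = vec-ext λ k →
    trans (Vecₚ.lookup∘tabulate (λ k′ → ∣ (true ∷ D) ∩ block blk k′ ∣) k)
      (card-cons-block (profile (blk ∘ Fin.suc) D) (blk Fin.zero) k (D ∩ block (blk ∘ Fin.suc) k)
        (sym (Vecₚ.lookup∘tabulate (λ k′ → ∣ D ∩ block (blk ∘ Fin.suc) k′ ∣) k)))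

  profile-insert : ∀ {n p} (blk : Fin n → Fin p) (D : Subset n) (x : Fin n) → x ∉ D →
    profile blk (D [ x ]≔ true) ≡ incr (profile blk D) (blk x)
  profile-insert blk (true ∷ D)  Fin.zero    x∉D = ⊥-elim (x∉D here)
  profile-insert blk (false ∷ D) Fin.zero    _   = profile-cons-in blk D
  profile-insert blk (false ∷ D) (Fin.suc x) x∉D = profile-insert (blk ∘ Fin.suc) D x (x∉D ∘ there)
  profile-insert blk (true ∷ D)  (Fin.suc x) x∉D = begin
      profile blk (true ∷ D [ x ]≔ true)
    ≡⟨ profile-cons-in blk (D [ x ]≔ true) ⟩
      incr (profile blk′ (D [ x ]≔ true)) (blk Fin.zero)
    ≡⟨ cong (λ v → incr v (blk Fin.zero)) (profile-insert blk′ D x (x∉D ∘ there)) ⟩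
      incr (incr (profile blk′ D) (blk′ x)) (blk Fin.zero)
    ≡⟨ incr-comm (profile blk′ D) (blk′ x) (blk Fin.zero) ⟩
      incr (incr (profile blk′ D) (blk Fin.zero)) (blk′ x)
    ≡⟨ cong (λ v → incr v (blk′ x)) (profile-cons-in blk D) ⟨
      incr (profile blk (true ∷ D)) (blk (Fin.suc x)) ∎
    where
    blk′ : Fin _ → Fin _
    blk′ = blk ∘ Fin.suc

  -- The entries of a profile add up to the cardinality of the set; this is how |D| - |B|
  -- in the Möbius transform becomes a function of the profiles.
  sum-incr : ∀ {p} (v : Vec ℕ p) j → Vec.sum (incr v j) ≡ suc (Vec.sum v)
  sum-incr (a ∷ v) Fin.zero    = refl
  sum-incr (a ∷ v) (Fin.suc j) = trans (cong (a ℕ.+_) (sum-incr v j)) (ℕₚ.+-suc a (Vec.sum v))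

  sum-zeros : ∀ p → Vec.sum (tabulate {n = p} (λ _ → 0)) ≡ 0
  sum-zeros zero    = refl
  sum-zeros (suc p) = sum-zeros p

  card≡sum-profile : ∀ {n p} (blk : Fin n → Fin p) (B : Subset n) → ∣ B ∣ ≡ Vec.sum (profile blk B)
  card≡sum-profile {p = p} blk []  = sym (sum-zeros p)
  card≡sum-profile blk (false ∷ B) = card≡sum-profile (blk ∘ Fin.suc) B
  card≡sum-profile blk (true ∷ B)  = begin
      suc ∣ B ∣
    ≡⟨ cong suc (card≡sum-profile (blk ∘ Fin.suc) B) ⟩
      suc (Vec.sum (profile (blk ∘ Fin.suc) B))
    ≡⟨ sum-incr (profile (blk ∘ Fin.suc) B) (blk Fin.zero) ⟨
      Vec.sum (incr (profile (blk ∘ Fin.suc) B) (blk Fin.zero))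
    ≡⟨ cong Vec.sum (profile-cons-in blk B) ⟨
      Vec.sum (profile blk (true ∷ B)) ∎

  _≤ᵛ_ : ∀ {p} → Vec ℕ p → Vec ℕ p → Set
  u ≤ᵛ v = ∀ k → lookup u k ℕ.≤ lookup v k

  profile-bounded : ∀ {n p} (blk : Fin n → Fin p) (D : Subset n) → profile blk D ≤ᵛ profile blk ⊤
  profile-bounded blk D k =
    subst₂ ℕ._≤_ (sym (Vecₚ.lookup∘tabulate _ k)) (sym (Vecₚ.lookup∘tabulate _ k))
      (p⊆q⇒∣p∣≤∣q∣ (λ x∈ → x∈p∩q⁺ (∈⊤ , proj₂ (x∈p∩q⁻ D (block blk k) x∈))))

  pred-bounded : ∀ {p} {c v : Vec ℕ p} j → c ≤ᵛ incr v j → updateAt c j pred ≤ᵛ v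
  pred-bounded {c = c} {v} j c≤ k with j ≟ k
  ... | yes refl = subst₂ ℕ._≤_ (sym (Vecₚ.lookup∘updateAt j c)) refl
                     (ℕₚ.pred-mono-≤ (subst (lookup c j ℕ.≤_) (Vecₚ.lookup∘updateAt j v) (c≤ j)))
  ... | no j≢k   = subst₂ ℕ._≤_ (sym (Vecₚ.lookup∘updateAt′ k j (j≢k ∘ sym) c))
                     (Vecₚ.lookup∘updateAt′ k j (j≢k ∘ sym) v) (c≤ k)

  ∣false∣≡0 : ∀ n → ∣ tabulate {n = n} (λ _ → false) ∣ ≡ 0
  ∣false∣≡0 zero    = refl
  ∣false∣≡0 (suc n) = ∣false∣≡0 n

  rank-zero : ∀ {n p} (blk : Fin (suc n) → Fin p) → rankInBlock blk Fin.zero ≡ 0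
  rank-zero {n} blk = trans (cong ∣_∣ (Vecₚ.tabulate-cong (λ y →
    cong (_∧ ⌊ blk y ≟ blk Fin.zero ⌋) (⌊⌋-false (y Fin.<? Fin.zero {n}) λ ()))))
    (∣false∣≡0 (suc n))

  rank-suc : ∀ {n p} (blk : Fin (suc n) → Fin p) (x : Fin n) →
    rankInBlock blk (Fin.suc x) ≡
      ∣ ⌊ blk Fin.zero ≟ blk (Fin.suc x) ⌋ ∷
        tabulate (λ y → ⌊ y Fin.<? x ⌋ ∧ ⌊ blk (Fin.suc y) ≟ blk (Fin.suc x) ⌋) ∣
  rank-suc {n} blk x = cong ∣_∣ (cong₂ _∷_
    (cong (_∧ ⌊ blk Fin.zero ≟ blk (Fin.suc x) ⌋) (⌊⌋-true (Fin.zero {n} Fin.<? Fin.suc x) (ℕ.s≤s ℕ.z≤n)))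
    (Vecₚ.tabulate-cong (λ y → cong (_∧ ⌊ blk (Fin.suc y) ≟ blk (Fin.suc x) ⌋)
      (⌊⌋-iff (Fin.suc y Fin.<? Fin.suc x) (y Fin.<? x) ℕ.s<s⁻¹ ℕ.s<s))))

  suc<⇔<pred : ∀ r m → ⌊ suc r ℕ.<? m ⌋ ≡ ⌊ r ℕ.<? pred m ⌋
  suc<⇔<pred r zero    = ⌊⌋-iff (suc r ℕ.<? 0) (r ℕ.<? 0) (λ ()) (λ ())
  suc<⇔<pred r (suc m) = ⌊⌋-iff (suc r ℕ.<? suc m) (r ℕ.<? m) ℕ.s<s⁻¹ ℕ.s<s

  lookup-pred : ∀ {p} (c : Vec ℕ p) {j k} → j ≡ k → lookup (updateAt c j pred) k ≡ pred (lookup c k)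
  lookup-pred c {j} refl = Vecₚ.lookup∘updateAt j c

  canonical-cons : ∀ {n p} (blk : Fin (suc n) → Fin p) (c : Vec ℕ p) →
    canonical blk c ≡
      ⌊ 0 ℕ.<? lookup c (blk Fin.zero) ⌋ ∷ canonical (blk ∘ Fin.suc) (updateAt c (blk Fin.zero) pred)
  canonical-cons blk c =
    cong₂ _∷_ (cong (λ r → ⌊ r ℕ.<? lookup c (blk Fin.zero) ⌋) (rank-zero blk)) (Vecₚ.tabulate-cong tail)
    where
    j : Fin _
    j = blk Fin.zero
    c′ : Vec ℕ _
    c′ = updateAt c j pred
    tail : ∀ x → ⌊ rankInBlock blk (Fin.suc x) ℕ.<? lookup c (blk (Fin.suc x)) ⌋ ≡
                 ⌊ rankInBlock (blk ∘ Fin.suc) x ℕ.<? lookup c′ (blk (Fin.suc x)) ⌋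
    tail x rewrite rank-suc blk x with j ≟ blk (Fin.suc x)
    ... | yes same  = trans (suc<⇔<pred _ _) (cong (λ m → ⌊ _ ℕ.<? m ⌋) (sym (lookup-pred c same)))
    ... | no  other = cong (λ m → ⌊ _ ℕ.<? m ⌋) (sym (Vecₚ.lookup∘updateAt′ (blk (Fin.suc x)) j (other ∘ sym) c))

  canonical-profile : ∀ {n p} (blk : Fin n → Fin p) (c : Vec ℕ p) → c ≤ᵛ profile blk ⊤ →
    profile blk (canonical blk c) ≡ c
  canonical-profile {zero} blk c c≤ = vec-ext λ k →
    trans (Vecₚ.lookup∘tabulate _ k)
      (sym (ℕₚ.n≤0⇒n≡0 (subst (lookup c k ℕ.≤_) (Vecₚ.lookup∘tabulate _ k) (c≤ k))))
  canonical-profile {suc n} blk c c≤ =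
    trans (cong (profile blk) (canonical-cons blk c)) (restore (lookup c j) refl)
    where
    j : Fin _
    j = blk Fin.zero
    blk′ : Fin n → Fin _
    blk′ = blk ∘ Fin.suc
    c′ : Vec ℕ _
    c′ = updateAt c j pred
    tail-profile : profile blk′ (canonical blk′ c′) ≡ c′
    tail-profile = canonical-profile blk′ c′ (pred-bounded {c = c} {profile blk′ ⊤} j λ k →
      subst (λ v → lookup c k ℕ.≤ lookup v k) (profile-cons-in blk ⊤) (c≤ k))
    restore : ∀ m → lookup c j ≡ m → profile blk (⌊ 0 ℕ.<? m ⌋ ∷ canonical blk′ c′) ≡ c
    restore zero    eq = trans tail-profile (Vecₚ.updateAt-id-local j c (trans (cong pred eq) (sym eq)))
    restore (suc m) eq = begin
        profile blk (true ∷ canonical blk′ c′)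
      ≡⟨ profile-cons-in blk (canonical blk′ c′) ⟩
        incr (profile blk′ (canonical blk′ c′)) j
      ≡⟨ cong (λ v → incr v j) tail-profile ⟩
        updateAt c′ j suc
      ≡⟨ Vecₚ.updateAt-updateAt-local j c (trans (cong (suc ∘ pred) eq) (sym eq)) ⟩
        updateAt c j id
      ≡⟨ Vecₚ.updateAt-id j c ⟩
        c ∎

  upperSet-∉ : ∀ {n} (σ : Permutation′ n) i → σ ⟨$⟩ʳ i ∉ upperSet σ (suc (toℕ i))
  upperSet-∉ σ i x∈ = ℕₚ.<-irrefl (cong toℕ (sym (inverseˡ σ))) (⌊⌋-true⇒ (suc (toℕ i) ℕ.≤? _)
    (trans (sym (Vecₚ.lookup∘tabulate _ (σ ⟨$⟩ʳ i))) (Vecₚ.[]=⇒lookup x∈)))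

  upperSet-step : ∀ {n} (σ : Permutation′ n) i →
    upperSet σ (toℕ i) ≡ upperSet σ (suc (toℕ i)) [ σ ⟨$⟩ʳ i ]≔ true
  upperSet-step σ i = vec-ext λ y → entry y (y ≟ σ ⟨$⟩ʳ i)
    where
    entry : ∀ y → Dec (y ≡ σ ⟨$⟩ʳ i) →
      lookup (upperSet σ (toℕ i)) y ≡ lookup (upperSet σ (suc (toℕ i)) [ σ ⟨$⟩ʳ i ]≔ true) y
    entry y (yes refl) = trans (Vecₚ.lookup∘tabulate _ y)
      (trans (⌊⌋-true (toℕ i ℕ.≤? _) (ℕₚ.≤-reflexive (cong toℕ (sym (inverseˡ σ)))))
        (sym (Vecₚ.lookup∘update y (upperSet σ (suc (toℕ i))) true)))
    entry y (no y≢x) = trans (Vecₚ.lookup∘tabulate _ y)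
      (trans (⌊⌋-iff (toℕ i ℕ.≤? _) (suc (toℕ i) ℕ.≤? _)
               (λ i≤ → ℕₚ.≤∧≢⇒< i≤ λ i≡ → y≢x (trans (sym (inverseʳ σ)) (cong (σ ⟨$⟩ʳ_) (sym (Finₚ.toℕ-injective i≡)))))
               ℕₚ.<⇒≤)
        (sym (trans (Vecₚ.lookup∘update′ y≢x (upperSet σ (suc (toℕ i))) true) (Vecₚ.lookup∘tabulate _ y))))

  trace-split : ∀ {n} (S Z : Subset n) → (S ∩ Z) ∪ (S ∩ ∁ Z) ≡ S
  trace-split S Z = begin
      (S ∩ Z) ∪ (S ∩ ∁ Z)  ≡⟨ ∩-distribˡ-∪ S Z (∁ Z) ⟨
      S ∩ (Z ∪ ∁ Z)        ≡⟨ cong (S ∩_) (p∪∁p≡⊤ Z) ⟩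
      S ∩ ⊤                ≡⟨ ∩-identityʳ S ⟩
      S                    ∎

  ∩-agree : ∀ {n} (S T Z : Subset n) → (∀ x → lookup Z x ≡ true → lookup S x ≡ lookup T x) → S ∩ Z ≡ T ∩ Z
  ∩-agree []      []      []          _     = refl
  ∩-agree (s ∷ S) (t ∷ T) (true ∷ Z)  agree =
    cong₂ _∷_ (cong (_∧ true) (agree Fin.zero refl)) (∩-agree S T Z (agree ∘ Fin.suc))
  ∩-agree (s ∷ S) (t ∷ T) (false ∷ Z) agree =
    cong₂ _∷_ (trans (∧-zeroʳ s) (sym (∧-zeroʳ t))) (∩-agree S T Z (agree ∘ Fin.suc))

  block-member : ∀ {n p} (blk : Fin n → Fin p) {k x} → blk x ≡ k → lookup (block blk k) x ≡ true
  block-member blk {k} {x} blk-x≡k = trans (Vecₚ.lookup∘tabulate _ x) (⌊⌋-true (blk x ≟ k) blk-x≡k)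

  in-block : ∀ {n p} (blk : Fin n → Fin p) {k x} → lookup (block blk k) x ≡ true → blk x ≡ k
  in-block blk {k} {x} x∈ = ⌊⌋-true⇒ (blk x ≟ k) (trans (sym (Vecₚ.lookup∘tabulate _ x)) x∈)

  out-of-block : ∀ {n p} (blk : Fin n → Fin p) {k x} → lookup (∁ (block blk k)) x ≡ true → blk x ≢ k
  out-of-block blk {k} {x} x∉ blk-x≡k with
    trans (cong not (sym (block-member blk blk-x≡k))) (trans (sym (Vecₚ.lookup-map x not (block blk k))) x∉)
  ... | ()

  same-block-size : ∀ {n p} (blk : Fin n → Fin p) {A A′ : Subset n} → profile blk A ≡ profile blk A′ →
    ∀ k → ∣ A ∩ block blk k ∣ ≡ ∣ A′ ∩ block blk k ∣
  same-block-size blk {A} {A′} same k = begin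
      ∣ A ∩ block blk k ∣        ≡⟨ Vecₚ.lookup∘tabulate (λ k′ → ∣ A ∩ block blk k′ ∣) k ⟨
      lookup (profile blk A) k   ≡⟨ cong (λ v → lookup v k) same ⟩
      lookup (profile blk A′) k  ≡⟨ Vecₚ.lookup∘tabulate (λ k′ → ∣ A′ ∩ block blk k′ ∣) k ⟩
      ∣ A′ ∩ block blk k ∣       ∎

  mix : ∀ {n p} → (Fin n → Fin p) → Subset n → Subset n → ℕ → Subset n
  mix blk A A′ t = tabulate λ x → if ⌊ toℕ (blk x) ℕ.<? t ⌋ then lookup A′ x else lookup A x

  module _ {n p} (blk : Fin n → Fin p) (A A′ : Subset n) where

    mix-below : ∀ t x → toℕ (blk x) ℕ.< t → lookup (mix blk A A′ t) x ≡ lookup A′ x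
    mix-below t x lt = trans (Vecₚ.lookup∘tabulate _ x)
      (cong (if_then lookup A′ x else lookup A x) (⌊⌋-true (toℕ (blk x) ℕ.<? t) lt))

    mix-above : ∀ t x → ¬ toℕ (blk x) ℕ.< t → lookup (mix blk A A′ t) x ≡ lookup A x
    mix-above t x ≮ = trans (Vecₚ.lookup∘tabulate _ x)
      (cong (if_then lookup A′ x else lookup A x) (⌊⌋-false (toℕ (blk x) ℕ.<? t) ≮))

    mix-start : mix blk A A′ 0 ≡ A
    mix-start = vec-ext λ x → mix-above 0 x λ ()

    mix-end : mix blk A A′ p ≡ A′
    mix-end = vec-ext λ x → mix-below p x (Finₚ.toℕ<n (blk x))

    mix-outside : ∀ k → mix blk A A′ (toℕ k) ∩ ∁ (block blk k) ≡ mix blk A A′ (suc (toℕ k)) ∩ ∁ (block blk k)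
    mix-outside k = ∩-agree _ _ _ λ x x∉ → trans (Vecₚ.lookup∘tabulate _ x)
      (trans (cong (if_then lookup A′ x else lookup A x)
               (⌊⌋-iff (toℕ (blk x) ℕ.<? toℕ k) (toℕ (blk x) ℕ.<? suc (toℕ k)) ℕₚ.m<n⇒m<1+n
                 λ lt → ℕₚ.≤∧≢⇒< (ℕ.s≤s⁻¹ lt) (out-of-block blk x∉ ∘ Finₚ.toℕ-injective)))
             (sym (Vecₚ.lookup∘tabulate _ x)))

    mix-inside-before : ∀ k → mix blk A A′ (toℕ k) ∩ block blk k ≡ A ∩ block blk k
    mix-inside-before k = ∩-agree _ _ _ λ x x∈ →
      mix-above _ x (ℕₚ.<-irrefl (cong toℕ (in-block blk x∈)))

    mix-inside-after : ∀ k → mix blk A A′ (suc (toℕ k)) ∩ block blk k ≡ A′ ∩ block blk k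
    mix-inside-after k = ∩-agree _ _ _ λ x x∈ →
      mix-below _ x (ℕ.s≤s (ℕₚ.≤-reflexive (cong toℕ (in-block blk x∈))))

module Proof {c ℓ ℓ′ : Level} (R : CommutativeRing c ℓ) (_≤_ : Rel (CommutativeRing.Carrier R) ℓ′) where
  open CommutativeRing R renaming (Carrier to K)
  open import Relation.Binary.Reasoning.Setoid setoid
  open import Algebra.Properties.Ring ring using (-‿distribˡ-*; -‿+-comm)
  open import Algebra.Properties.CommutativeSemigroup +-commutativeSemigroup using (interchange)
  open import Algebra.Properties.CommutativeMonoid.Mult +-commutativeMonoid
    using (_×_; ×-congʳ; ×-homo-+; ×-homo-1; ×-assocˡ; ×-distrib-+)
  open Combinatorics

  Σlist : {A : Set} → List A → (A → K) → K
  Σlist = ΣL R _≤_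

  Σlist-cong : {A : Set} (xs : List A) {g h : A → K} → (∀ a → g a ≈ h a) → Σlist xs g ≈ Σlist xs h
  Σlist-cong []       g≈h = refl
  Σlist-cong (x ∷ xs) g≈h = +-cong (g≈h x) (Σlist-cong xs g≈h)

  Σlist-zero : {A : Set} (xs : List A) → Σlist xs (λ _ → 0#) ≈ 0#
  Σlist-zero []       = refl
  Σlist-zero (x ∷ xs) = trans (+-identityˡ _) (Σlist-zero xs)

  Σlist-++ : {A : Set} (xs ys : List A) (g : A → K) → Σlist (xs ++ ys) g ≈ Σlist xs g + Σlist ys g
  Σlist-++ []       ys g = sym (+-identityˡ _)
  Σlist-++ (x ∷ xs) ys g = trans (+-congˡ (Σlist-++ xs ys g)) (sym (+-assoc _ _ _))

  Σlist-map : {A B : Set} (f : A → B) (xs : List A) (g : B → K) → Σlist (List.map f xs) g ≡ Σlist xs (g ∘ f)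
  Σlist-map f []       g = ≡.refl
  Σlist-map f (x ∷ xs) g = ≡.cong (g (f x) +_) (Σlist-map f xs g)

  Σlist-concatMap : {A B : Set} (f : A → List B) (xs : List A) (g : B → K) →
    Σlist (List.concatMap f xs) g ≈ Σlist xs (λ a → Σlist (f a) g)
  Σlist-concatMap f []       g = refl
  Σlist-concatMap f (x ∷ xs) g =
    trans (Σlist-++ (f x) (List.concatMap f xs) g) (+-congˡ (Σlist-concatMap f xs g))

  ×-zero : ∀ m → m × 0# ≈ 0#
  ×-zero zero    = refl
  ×-zero (suc m) = trans (+-identityˡ _) (×-zero m)

  ×-Σlist : {A : Set} (m : ℕ) (xs : List A) (g : A → K) → m × Σlist xs g ≈ Σlist xs (λ a → m × g a)
  ×-Σlist m []       g = ×-zero m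
  ×-Σlist m (x ∷ xs) g = trans (×-distrib-+ _ _ m) (+-congˡ (×-Σlist m xs g))

  ΣF-cong : ∀ n {g h : Fin n → K} → (∀ i → g i ≈ h i) → ΣF R _≤_ g ≈ ΣF R _≤_ h
  ΣF-cong zero    g≈h = refl
  ΣF-cong (suc n) g≈h = +-cong (g≈h Fin.zero) (ΣF-cong n (g≈h ∘ Fin.suc))

  Σ⊆ : ∀ {n} → Subset n → (Subset n → K) → K
  Σ⊆ []          h = h []
  Σ⊆ (true ∷ S)  h = Σ⊆ S (λ D → h (true ∷ D)) + Σ⊆ S (λ D → h (false ∷ D))
  Σ⊆ (false ∷ S) h = Σ⊆ S (λ D → h (false ∷ D))

  Σ⊆-cong : ∀ {n} (S : Subset n) {g h : Subset n → K} → (∀ D → D ⊆ S → g D ≈ h D) → Σ⊆ S g ≈ Σ⊆ S h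
  Σ⊆-cong []          g≈h = g≈h [] λ ()
  Σ⊆-cong (true ∷ S)  g≈h = +-cong (Σ⊆-cong S λ D D⊆S → g≈h (true ∷ D) (s⊆s D⊆S))
                                   (Σ⊆-cong S λ D D⊆S → g≈h (false ∷ D) (out⊆ D⊆S))
  Σ⊆-cong (false ∷ S) g≈h = Σ⊆-cong S λ D D⊆S → g≈h (false ∷ D) (out⊆ D⊆S)

  Σ⊆-+ : ∀ {n} (S : Subset n) (g h : Subset n → K) → Σ⊆ S (λ D → g D + h D) ≈ Σ⊆ S g + Σ⊆ S h
  Σ⊆-+ []          g h = refl
  Σ⊆-+ (true ∷ S)  g h = trans (+-cong (Σ⊆-+ S _ _) (Σ⊆-+ S _ _)) (interchange _ _ _ _)
  Σ⊆-+ (false ∷ S) g h = Σ⊆-+ S _ _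

  Σ⊆-neg : ∀ {n} (S : Subset n) (g : Subset n → K) → Σ⊆ S (λ D → - g D) ≈ - Σ⊆ S g
  Σ⊆-neg []          g = refl
  Σ⊆-neg (true ∷ S)  g = trans (+-cong (Σ⊆-neg S _) (Σ⊆-neg S _)) (-‿+-comm _ _)
  Σ⊆-neg (false ∷ S) g = Σ⊆-neg S _

  Σsubsets-cons : ∀ {n} (g : Subset (suc n) → K) →
    Σlist (subsets (suc n)) g ≈ Σlist (subsets n) (g ∘ (true ∷_)) + Σlist (subsets n) (g ∘ (false ∷_))
  Σsubsets-cons {n} g = trans (Σlist-++ (List.map (true ∷_) (subsets n)) _ g)
    (reflexive (≡.cong₂ _+_ (Σlist-map (true ∷_) (subsets n) g) (Σlist-map (false ∷_) (subsets n) g)))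

  Σsubsets-tail : ∀ {n} (b s : Bool) (S : Subset n) (h : Subset (suc n) → K) →
    (∀ D → ⌊ (b ∷ D) ⊆? (s ∷ S) ⌋ ≡ ⌊ D ⊆? S ⌋) →
    Σlist (subsets n) (λ D → if ⌊ (b ∷ D) ⊆? (s ∷ S) ⌋ then h (b ∷ D) else 0#) ≈
    Σlist (subsets n) (λ D → if ⌊ D ⊆? S ⌋ then h (b ∷ D) else 0#)
  Σsubsets-tail b s S h same = Σlist-cong (subsets _) λ D →
    reflexive (≡.cong (λ t → if t then h (b ∷ D) else 0#) (same D))

  Σsubsets≈Σ⊆ : ∀ {n} (S : Subset n) (h : Subset n → K) →
    Σlist (subsets n) (λ D → if ⌊ D ⊆? S ⌋ then h D else 0#) ≈ Σ⊆ S h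
  Σsubsets≈Σ⊆ []          h = +-identityʳ _
  Σsubsets≈Σ⊆ (true ∷ S)  h = trans (Σsubsets-cons (λ D → if ⌊ D ⊆? true ∷ S ⌋ then h D else 0#))
    (+-cong (trans (Σsubsets-tail true  true S h λ D → ⌊⌋-map′ _ _ (D ⊆? S)) (Σsubsets≈Σ⊆ S _))
            (trans (Σsubsets-tail false true S h λ D → ⌊⌋-map′ _ _ (D ⊆? S)) (Σsubsets≈Σ⊆ S _)))
  Σsubsets≈Σ⊆ {suc n} (false ∷ S) h = begin
      Σlist (subsets (suc n)) (λ D → if ⌊ D ⊆? false ∷ S ⌋ then h D else 0#)
    ≈⟨ Σsubsets-cons (λ D → if ⌊ D ⊆? false ∷ S ⌋ then h D else 0#) ⟩
      Σlist (subsets n) (λ _ → 0#) + Σlist (subsets n) (λ D → if ⌊ false ∷ D ⊆? false ∷ S ⌋ then h (false ∷ D) else 0#)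
    ≈⟨ trans (+-congʳ (Σlist-zero (subsets n))) (+-identityˡ _) ⟩
      Σlist (subsets n) (λ D → if ⌊ false ∷ D ⊆? false ∷ S ⌋ then h (false ∷ D) else 0#)
    ≈⟨ trans (Σsubsets-tail false false S h λ D → ⌊⌋-map′ _ _ (D ⊆? S)) (Σsubsets≈Σ⊆ S _) ⟩
      Σ⊆ (false ∷ S) h ∎

  -- Inserting a new element x into S: a subset of S ∪ {x} either avoids x or is D ∪ {x}, D ⊆ S.
  Σ⊆-insert : ∀ {n} (S : Subset n) (x : Fin n) (h : Subset n → K) → x ∉ S →
    Σ⊆ (S [ x ]≔ true) h ≈ Σ⊆ S h + Σ⊆ S (λ D → h (D [ x ]≔ true))
  Σ⊆-insert (true ∷ S)  Fin.zero    h x∉S = ⊥-elim (x∉S here)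
  Σ⊆-insert (false ∷ S) Fin.zero    h _   = +-comm _ _
  Σ⊆-insert (true ∷ S)  (Fin.suc x) h x∉S =
    trans (+-cong (Σ⊆-insert S x _ (x∉S ∘ there)) (Σ⊆-insert S x _ (x∉S ∘ there))) (interchange _ _ _ _)
  Σ⊆-insert (false ∷ S) (Fin.suc x) h x∉S = Σ⊆-insert S x _ (x∉S ∘ there)

  sgn : ℕ → K
  sgn = sign R _≤_

  möbius⊆ : ∀ {n} → (Subset n → K) → Subset n → K
  möbius⊆ μ D = Σ⊆ D (λ B → sgn (∣ D ∣ ∸ ∣ B ∣) * μ B)

  möbius≈möbius⊆ : ∀ {n} (μ : Subset n → K) D → möbius R _≤_ μ D ≈ möbius⊆ μ D
  möbius≈möbius⊆ μ D = Σsubsets≈Σ⊆ D (λ B → sgn (∣ D ∣ ∸ ∣ B ∣) * μ B)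

  -- Adding the first element x₀ to D flips the sign of every term:
  -- m_μ(x₀ ∪ D) = m_{μ(x₀ ∪ ·)}(D) - m_{μ}(D) (the latter restricted to sets avoiding x₀).
  möbius⊆-cons-in : ∀ {n} (μ : Subset (suc n) → K) D →
    möbius⊆ μ (true ∷ D) ≈ möbius⊆ (μ ∘ (true ∷_)) D + - möbius⊆ (μ ∘ (false ∷_)) D
  möbius⊆-cons-in μ D = +-congˡ (trans (Σ⊆-cong D λ B B⊆D → trans
      (*-congʳ (reflexive (≡.cong sgn (ℕₚ.+-∸-assoc 1 (p⊆q⇒∣p∣≤∣q∣ B⊆D)))))
      (sym (-‿distribˡ-* _ _)))
    (Σ⊆-neg D _))

  möbius-inversion : ∀ {n} (A : Subset n) (μ : Subset n → K) → Σ⊆ A (möbius⊆ μ) ≈ μ A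
  möbius-inversion []          μ = *-identityˡ _
  möbius-inversion (false ∷ A) μ = möbius-inversion A (μ ∘ (false ∷_))
  möbius-inversion (true ∷ A)  μ = begin
      Σ⊆ A (möbius⊆ μ ∘ (true ∷_)) + Σ⊆ A (möbius⊆ μ ∘ (false ∷_))
    ≈⟨ +-congʳ (Σ⊆-cong A λ D _ → möbius⊆-cons-in μ D) ⟩
      Σ⊆ A (λ D → möbius⊆ μin D + - möbius⊆ μout D) + Σ⊆ A (möbius⊆ μout)
    ≈⟨ +-congʳ (trans (Σ⊆-+ A _ _) (+-congˡ (Σ⊆-neg A _))) ⟩
      (Σ⊆ A (möbius⊆ μin) + - Σ⊆ A (möbius⊆ μout)) + Σ⊆ A (möbius⊆ μout)
    ≈⟨ trans (+-assoc _ _ _) (trans (+-congˡ (-‿inverseˡ _)) (+-identityʳ _)) ⟩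
      Σ⊆ A (möbius⊆ μin)
    ≈⟨ möbius-inversion A μin ⟩
      μ (true ∷ A) ∎
    where
    μin μout : Subset _ → K
    μin  = μ ∘ (true ∷_)
    μout = μ ∘ (false ∷_)

  Σ< : ℕ → (ℕ → K) → K
  Σ< zero    g = 0#
  Σ< (suc n) g = g 0 + Σ< n (g ∘ suc)

  Σlist-applyUpTo : ∀ (f : ℕ → ℕ) n (g : ℕ → K) → Σlist (List.applyUpTo f n) g ≡ Σ< n (g ∘ f)
  Σlist-applyUpTo f zero    g = ≡.refl
  Σlist-applyUpTo f (suc n) g = ≡.cong (g (f 0) +_) (Σlist-applyUpTo (f ∘ suc) n g)

  Σ<-cong : ∀ n {g h : ℕ → K} → (∀ i → g i ≈ h i) → Σ< n g ≈ Σ< n h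
  Σ<-cong zero    g≈h = refl
  Σ<-cong (suc n) g≈h = +-cong (g≈h 0) (Σ<-cong n (g≈h ∘ suc))

  Σ<-+ : ∀ n (g h : ℕ → K) → Σ< n (λ i → g i + h i) ≈ Σ< n g + Σ< n h
  Σ<-+ zero    g h = sym (+-identityˡ _)
  Σ<-+ (suc n) g h = trans (+-congˡ (Σ<-+ n _ _)) (interchange _ _ _ _)

  Σ<-last : ∀ n (g : ℕ → K) → Σ< (suc n) g ≈ Σ< n g + g n
  Σ<-last zero    g = trans (+-identityʳ _) (sym (+-identityˡ _))
  Σ<-last (suc n) g = trans (+-congˡ (Σ<-last n _)) (sym (+-assoc _ _ _))

  binomial-pascal : ∀ b (H : ℕ → K) →
    Σ< (suc (suc b)) (λ c → (suc b C c) × H c) ≈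
    Σ< (suc b) (λ c → (b C c) × H (suc c)) + Σ< (suc b) (λ c → (b C c) × H c)
  binomial-pascal b H = begin
      1 × H 0 + Σ< (suc b) (λ c → (suc b C suc c) × H (suc c))
    ≈⟨ +-congˡ (Σ<-cong (suc b) λ c → trans
         (reflexive (≡.cong (_× H (suc c)) (≡.sym (nCk+nC[k+1]≡[n+1]C[k+1] b c)))) (×-homo-+ _ (b C c) _)) ⟩
      1 × H 0 + Σ< (suc b) (λ c → (b C c) × H (suc c) + (b C suc c) × H (suc c))
    ≈⟨ +-congˡ (Σ<-+ (suc b) (λ c → (b C c) × H (suc c)) (λ c → (b C suc c) × H (suc c))) ⟩
      1 × H 0 + (shifted + Σ< (suc b) (λ c → (b C suc c) × H (suc c)))
    ≈⟨ +-congˡ (+-congˡ (Σ<-last b _)) ⟩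
      1 × H 0 + (shifted + (rest + (b C suc b) × H (suc b)))
    ≈⟨ +-congˡ (+-congˡ (+-congˡ (reflexive (≡.cong (_× H (suc b)) (k>n⇒nCk≡0 (ℕₚ.n<1+n b)))))) ⟩
      1 × H 0 + (shifted + (rest + 0#))
    ≈⟨ +-congˡ (+-congˡ (+-identityʳ rest)) ⟩
      1 × H 0 + (shifted + rest)
    ≈⟨ trans (sym (+-assoc _ _ _)) (trans (+-congʳ (+-comm _ _)) (+-assoc _ _ _)) ⟩
      shifted + (1 × H 0 + rest) ∎
    where
    shifted rest : K
    shifted = Σ< (suc b) (λ c → (b C c) × H (suc c))
    rest    = Σ< b (λ c → (b C suc c) × H (suc c))

  Σbox : ∀ {p} → Vec ℕ p → (Vec ℕ p → K) → K
  Σbox b G = Σlist (box b) (λ c → binomProd R _≤_ b c × G c)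

  Σbox-cons : ∀ {p} b (bs : Vec ℕ p) G →
    Σbox (b ∷ bs) G ≈ Σ< (suc b) (λ c → (b C c) × Σbox bs (G ∘ (c ∷_)))
  Σbox-cons b bs G = begin
      Σbox (b ∷ bs) G
    ≈⟨ Σlist-concatMap (λ c → List.map (c ∷_) (box bs)) (List.upTo (suc b)) _ ⟩
      Σlist (List.upTo (suc b)) (λ c → Σlist (List.map (c ∷_) (box bs)) (λ cs → binomProd R _≤_ (b ∷ bs) cs × G cs))
    ≈⟨ Σlist-cong (List.upTo (suc b)) (λ c → trans (reflexive (Σlist-map (c ∷_) (box bs) _))
         (trans (Σlist-cong (box bs) λ cs → sym (×-assocˡ _ (b C c) _))
                (sym (×-Σlist (b C c) (box bs) _)))) ⟩
      Σlist (List.upTo (suc b)) (λ c → (b C c) × Σbox bs (G ∘ (c ∷_)))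
    ≡⟨ Σlist-applyUpTo id (suc b) _ ⟩
      Σ< (suc b) (λ c → (b C c) × Σbox bs (G ∘ (c ∷_))) ∎

  Σbox-incr : ∀ {p} (b : Vec ℕ p) (j : Fin p) (G : Vec ℕ p → K) →
    Σbox (incr b j) G ≈ Σbox b (λ c → G (incr c j)) + Σbox b G
  Σbox-incr (b ∷ bs) Fin.zero G = begin
      Σbox (suc b ∷ bs) G
    ≈⟨ Σbox-cons (suc b) bs G ⟩
      Σ< (suc (suc b)) (λ c → (suc b C c) × H c)
    ≈⟨ binomial-pascal b H ⟩
      Σ< (suc b) (λ c → (b C c) × H (suc c)) + Σ< (suc b) (λ c → (b C c) × H c)
    ≈⟨ sym (+-cong (Σbox-cons b bs _) (Σbox-cons b bs G)) ⟩
      Σbox (b ∷ bs) (λ c → G (incr c Fin.zero)) + Σbox (b ∷ bs) G ∎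
    where
    H : ℕ → K
    H c = Σbox bs (G ∘ (c ∷_))
  Σbox-incr (b ∷ bs) (Fin.suc j) G = begin
      Σbox (b ∷ incr bs j) G
    ≈⟨ Σbox-cons b (incr bs j) G ⟩
      Σ< (suc b) (λ c → (b C c) × Σbox (incr bs j) (G ∘ (c ∷_)))
    ≈⟨ Σ<-cong (suc b) (λ c → trans (×-congʳ (b C c) (Σbox-incr bs j (G ∘ (c ∷_)))) (×-distrib-+ _ _ (b C c))) ⟩
      Σ< (suc b) (λ c → (b C c) × Σbox bs (λ cs → G (c ∷ incr cs j)) + (b C c) × Σbox bs (G ∘ (c ∷_)))
    ≈⟨ Σ<-+ (suc b) (λ c → (b C c) × Σbox bs (λ cs → G (c ∷ incr cs j))) (λ c → (b C c) × Σbox bs (G ∘ (c ∷_))) ⟩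
      Σ< (suc b) (λ c → (b C c) × Σbox bs (λ cs → G (c ∷ incr cs j))) + Σ< (suc b) (λ c → (b C c) × Σbox bs (G ∘ (c ∷_)))
    ≈⟨ sym (+-cong (Σbox-cons b bs _) (Σbox-cons b bs G)) ⟩
      Σbox (b ∷ bs) (λ c → G (incr c (Fin.suc j))) + Σbox (b ∷ bs) G ∎

  Σbox-zeros : ∀ p (G : Vec ℕ p → K) → Σbox (tabulate (λ _ → 0)) G ≈ G (tabulate (λ _ → 0))
  Σbox-zeros zero    G = trans (+-identityʳ _) (×-homo-1 _)
  Σbox-zeros (suc p) G = begin
      Σbox (0 ∷ tabulate (λ _ → 0)) G
    ≈⟨ Σbox-cons 0 (tabulate (λ _ → 0)) G ⟩
      1 × Σbox (tabulate (λ _ → 0)) (G ∘ (0 ∷_)) + 0#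
    ≈⟨ trans (+-identityʳ _) (×-homo-1 _) ⟩
      Σbox (tabulate (λ _ → 0)) (G ∘ (0 ∷_))
    ≈⟨ Σbox-zeros p _ ⟩
      G (0 ∷ tabulate (λ _ → 0)) ∎

  -- Counting by profiles: a sum over the subsets of S of a function of the profile
  -- is a binomially weighted sum over the box below the profile of S, since there are
  -- Π_k C(b_k, c_k) subsets of profile c in a set of profile b.
  Σ⊆-by-profile : ∀ {n p} (blk : Fin n → Fin p) (S : Subset n) (G : Vec ℕ p → K) →
    Σ⊆ S (G ∘ profile blk) ≈ Σbox (profile blk S) G
  Σ⊆-by-profile {p = p} blk [] G = sym (Σbox-zeros p G)
  Σ⊆-by-profile blk (false ∷ S) G = Σ⊆-by-profile (blk ∘ Fin.suc) S G
  Σ⊆-by-profile blk (true ∷ S) G = begin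
      Σ⊆ S (G ∘ profile blk ∘ (true ∷_)) + Σ⊆ S (G ∘ profile blk′)
    ≈⟨ +-congʳ (Σ⊆-cong S λ D _ → reflexive (≡.cong G (profile-cons-in blk D))) ⟩
      Σ⊆ S (λ D → G (incr (profile blk′ D) j)) + Σ⊆ S (G ∘ profile blk′)
    ≈⟨ +-cong (Σ⊆-by-profile blk′ S (λ c → G (incr c j))) (Σ⊆-by-profile blk′ S G) ⟩
      Σbox (profile blk′ S) (λ c → G (incr c j)) + Σbox (profile blk′ S) G
    ≈⟨ Σbox-incr (profile blk′ S) j G ⟨
      Σbox (incr (profile blk′ S) j) G
    ≡⟨ ≡.cong (λ v → Σbox v G) (profile-cons-in blk S) ⟨
      Σbox (profile blk (true ∷ S)) G ∎
    where
    blk′ : Fin _ → Fin _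
    blk′ = blk ∘ Fin.suc
    j : Fin _
    j = blk Fin.zero

  exchange : ∀ {n} (μ : Subset n → K) (Z S T : Subset n) → IsIndifferent R _≤_ μ Z →
    S ∩ ∁ Z ≡ T ∩ ∁ Z → ∣ S ∩ Z ∣ ≡ ∣ T ∩ Z ∣ → μ S ≈ μ T
  exchange μ Z S T indifferent outside sizes = begin
      μ S                       ≡⟨ ≡.cong μ (trace-split S Z) ⟨
      μ ((S ∩ Z) ∪ (S ∩ ∁ Z))  ≈⟨ indifferent (S ∩ Z) (T ∩ Z) (S ∩ ∁ Z) (p∩q⊆q S Z) (p∩q⊆q T Z) sizes (p∩q⊆q S (∁ Z)) ⟩
      μ ((T ∩ Z) ∪ (S ∩ ∁ Z))  ≡⟨ ≡.cong (λ C → μ ((T ∩ Z) ∪ C)) outside ⟩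
      μ ((T ∩ Z) ∪ (T ∩ ∁ Z))  ≡⟨ ≡.cong μ (trace-split T Z) ⟩
      μ T                       ∎

  -- If every block is a set of indifference, μ depends only on the profile: replace
  -- A by A′ one block at a time, each step being an exchange inside that block.
  profile-invariance : ∀ {n p} (μ : Subset n → K) (blk : Fin n → Fin p) →
    (∀ k → IsIndifferent R _≤_ μ (block blk k)) →
    ∀ A A′ → profile blk A ≡ profile blk A′ → μ A ≈ μ A′
  profile-invariance {n} {p} μ blk indifferent A A′ same =
    ≡.subst₂ (λ X Y → μ X ≈ μ Y) (mix-start blk A A′) (mix-end blk A A′) (sweep p ℕₚ.≤-refl)
    where
    stage : ℕ → Subset n
    stage = mix blk A A′

    step : ∀ k → μ (stage (toℕ k)) ≈ μ (stage (suc (toℕ k)))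
    step k = exchange μ (block blk k) _ _ (indifferent k) (mix-outside blk A A′ k)
      (≡.trans (≡.cong ∣_∣ (mix-inside-before blk A A′ k))
        (≡.trans (same-block-size blk {A} {A′} same k) (≡.cong ∣_∣ (≡.sym (mix-inside-after blk A A′ k)))))

    sweep : ∀ t → t ℕ.≤ p → μ (stage 0) ≈ μ (stage t)
    sweep zero    _   = refl
    sweep (suc t) t<p = trans (sweep t (ℕₚ.<⇒≤ t<p))
      (≡.subst (λ s → μ (stage s) ≈ μ (stage (suc s))) (Finₚ.toℕ-fromℕ< t<p) (step (Fin.fromℕ< t<p)))

  module _ {n p} (μ : Subset n → K) (blk : Fin n → Fin p)
           (indifferent : ∀ k → IsIndifferent R _≤_ μ (block blk k)) where

    μᶜ : Vec ℕ p → K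
    μᶜ c = μ (canonical blk c)

    μ-by-profile : ∀ B → μ B ≈ μᶜ (profile blk B)
    μ-by-profile B = profile-invariance μ blk indifferent B (canonical blk (profile blk B))
      (≡.sym (canonical-profile blk (profile blk B) (profile-bounded blk B)))

    -- Grouping the subsets B ⊆ D by profile gives an explicit formula for m(D) in
    -- terms of the profile b of D: m(D) = Σ_{c ≤ b} Π_k C(b_k,c_k) (-1)^{|b|-|c|} μᶜ(c).
    möbius-formula : Vec ℕ p → K
    möbius-formula b = Σbox b (λ c → sgn (Vec.sum b ∸ Vec.sum c) * μᶜ c)

    möbius-by-formula : ∀ D → möbius R _≤_ μ D ≈ möbius-formula (profile blk D)
    möbius-by-formula D = begin
        möbius R _≤_ μ D
      ≈⟨ möbius≈möbius⊆ μ D ⟩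
        Σ⊆ D (λ B → sgn (∣ D ∣ ∸ ∣ B ∣) * μ B)
      ≈⟨ Σ⊆-cong D (λ B _ → *-cong (reflexive (≡.cong₂ (λ a b → sgn (a ∸ b))
           (card≡sum-profile blk D) (card≡sum-profile blk B))) (μ-by-profile B)) ⟩
        Σ⊆ D (λ B → sgn (Vec.sum (profile blk D) ∸ Vec.sum (profile blk B)) * μᶜ (profile blk B))
      ≈⟨ Σ⊆-by-profile blk D (λ c → sgn (Vec.sum (profile blk D) ∸ Vec.sum c) * μᶜ c) ⟩
        möbius-formula (profile blk D) ∎

    möbius-by-profile : ∀ D → möbius R _≤_ μ D ≈ möbiusProfile R _≤_ μ blk (profile blk D)
    möbius-by-profile D = trans (möbius-by-formula D) (sym (trans (möbius-by-formula (canonical blk b))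
      (reflexive (≡.cong möbius-formula (canonical-profile blk b (profile-bounded blk D))))))
      where
      b : Vec ℕ p
      b = profile blk D

    -- The increment of μ when a new point x joins S, by Möbius inversion:
    -- μ(S ∪ {x}) - μ(S) = Σ_{D ⊆ S} m(D ∪ {x}) = Σ_{c ≤ b} Π_k C(b_k,c_k) m(c + e_{j(x)}).
    increment : ∀ (S : Subset n) x → x ∉ S →
      μ (S [ x ]≔ true) - μ S ≈ Σbox (profile blk S) (λ c → möbiusProfile R _≤_ μ blk (incr c (blk x)))
    increment S x x∉S = begin
        μ (S [ x ]≔ true) - μ S
      ≈⟨ sym (+-cong (möbius-inversion (S [ x ]≔ true) μ) (-‿cong (möbius-inversion S μ))) ⟩
        Σ⊆ (S [ x ]≔ true) (möbius⊆ μ) - Σ⊆ S (möbius⊆ μ)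
      ≈⟨ +-congʳ (Σ⊆-insert S x (möbius⊆ μ) x∉S) ⟩
        (Σ⊆ S (möbius⊆ μ) + Σ⊆ S (λ D → möbius⊆ μ (D [ x ]≔ true))) - Σ⊆ S (möbius⊆ μ)
      ≈⟨ trans (+-congʳ (+-comm _ _)) (trans (+-assoc _ _ _) (trans (+-congˡ (-‿inverseʳ _)) (+-identityʳ _))) ⟩
        Σ⊆ S (λ D → möbius⊆ μ (D [ x ]≔ true))
      ≈⟨ Σ⊆-cong S (λ D D⊆S → trans (sym (möbius≈möbius⊆ μ (D [ x ]≔ true)))
           (trans (möbius-by-profile (D [ x ]≔ true))
             (reflexive (≡.cong (möbiusProfile R _≤_ μ blk) (profile-insert blk D x (x∉S ∘ D⊆S)))))) ⟩
        Σ⊆ S (λ D → möbiusProfile R _≤_ μ blk (incr (profile blk D) (blk x)))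
      ≈⟨ Σ⊆-by-profile blk S (λ c → möbiusProfile R _≤_ μ blk (incr c (blk x))) ⟩
        Σbox (profile blk S) (λ c → möbiusProfile R _≤_ μ blk (incr c (blk x))) ∎

  -- The Choquet integral equals the right-hand side term by term: the i-th weight
  -- μ(B_i) - μ(B_{i+1}) is the increment of μ when x_(i) joins B_{i+1}.
  choquet≈rhs : ∀ {n p} (μ : Subset n → K) (blk : Fin n → Fin p) (f : Fin n → K) (σ : Permutation′ n) →
    (∀ k → IsIndifferent R _≤_ μ (block blk k)) → choquet R _≤_ μ f σ ≈ rhs R _≤_ μ blk f σ
  choquet≈rhs {n} μ blk f σ indifferent = ΣF-cong n λ i → *-congˡ (begin
      μ (upperSet σ (toℕ i)) - μ (upperSet σ (suc (toℕ i)))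
    ≡⟨ ≡.cong (λ X → μ X - μ (upperSet σ (suc (toℕ i)))) (upperSet-step σ i) ⟩
      μ (upperSet σ (suc (toℕ i)) [ σ ⟨$⟩ʳ i ]≔ true) - μ (upperSet σ (suc (toℕ i)))
    ≈⟨ increment μ blk indifferent (upperSet σ (suc (toℕ i))) (σ ⟨$⟩ʳ i) (upperSet-∉ σ i) ⟩
      Σbox (profile blk (upperSet σ (suc (toℕ i)))) (λ c → möbiusProfile R _≤_ μ blk (incr c (blk (σ ⟨$⟩ʳ i)))) ∎)

-- Proposition 5.1.
proposition5p1 : ∀ {c ℓ ℓ′ : Level} (R : CommutativeRing c ℓ) (_≤_ : Rel (CommutativeRing.Carrier R) ℓ′)
    (n p : ℕ) (μ : Subset n → CommutativeRing.Carrier R) (blk : Fin n → Fin p)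
    (f : Fin n → CommutativeRing.Carrier R) (σ : Permutation′ n) →
    IsFuzzyMeasure R _≤_ μ →
    IsPSymmetric R _≤_ μ blk →
    (∀ x → CommutativeRing.0# R ≤ f x) →
    Sorts R _≤_ f σ →
    CommutativeRing._≈_ R (choquet R _≤_ μ f σ) (rhs R _≤_ μ blk f σ)
proposition5p1 R _≤_ n p μ blk f σ _ p-symmetric _ _ =
  Proof.choquet≈rhs R _≤_ μ blk f σ blocks-indifferent
  where
  blocks-indifferent : ∀ k → IsIndifferent R _≤_ μ (block blk k)
  blocks-indifferent = proj₂ (proj₁ p-symmetric)
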